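{- Let $k\ge 2$, let $H_0$ be a finite $k$-uniform hypergraph, let $H_t=\mathrm{ILTH}_t(H_0)$, and let $t\ge 0$. If $H_t$ contains $x$ motifs with cardinality vector $(a,b,c,d,e,f,g)$ (of some motif type $i$), then $H_{t+1}$ contains at least $$x\bigl(g+(c+1)d+(b+1)f+(a+1)e+(a+1)(b+1)(c+1)\bigr)$$ motifs with cardinality vector $(a,b,c,d,e,f,g)$ (and hence of the same type $i$).
   Context: ILTH model: fix $k\ge 2$ and a finite $k$-uniform hypergraph $H_0$; given $H_t$, $H_{t+1}$ has vertex set $V(H_t)\cup\{y':y\in V(H_t)\}$ where each $y'$ is a new vertex (the clone of $y$), and hyperedge set $E(H_t)\cup\{(e\setminus\{y\})\cup\{y'\}: e\in E(H_t), y\in e\}$. A motif in a hypergraph is an ordered triple $(e_1,e_2,e_3)$ of distinct hyperedges. Its cardinality vector is $(a,b,c,d,e,f,g)=(|e_1\setminus(e_2\cup e_3)|,|e_2\setminus(e_1\cup e_3)|,|e_3\setminus(e_1\cup e_2)|,|(e_1\cap e_2)\setminus e_3|,|(e_2\cap e_3)\setminus e_1|,|(e_1\cap e_3)\setminus e_2|,|e_1\cap e_2\cap e_3|)$, and its type is the binary string $i_1\cdots i_7$ with $i_j=1$ iff the $j$-th entry of the cardinality vector is positive (up to relabeling of the three hyperedges). -}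

module Defs where

open import Data.Nat using (ℕ; _+_)
open import Data.Bool using (Bool; false) renaming (_≟_ to _≟B_)
open import Data.Fin using (Fin; raise)
open import Data.Fin.Subset using (Subset; _∩_; _∪_; ∁; ∣_∣; ⁅_⁆; outside)
open import Data.Fin.Subset.Properties using (_∈?_)
open import Data.Vec using (Vec; _∷_; []; replicate; _[_]≔_) renaming (_++_ to _++ᵥ_)
open import Data.Vec.Properties using (≡-dec)
open import Data.List using (List; length; lookup; filter; allFin; map; concatMap; _++_; cartesianProduct)
open import Data.List.Relation.Unary.All using (All)
open import Data.List.Relation.Unary.Unique.Propositional using (Unique)
open import Data.Product using (_×_; _,_)
open import Relation.Nullary using (¬?)
open import Relation.Nullary.Decidable using (_×-dec_)
open import Relation.Binary.PropositionalEquality using (_≡_)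
open import Relation.Binary using (DecidableEquality)

record Hypergraph : Set where
  constructor hyp
  field
    n     : ℕ
    edges : List (Subset n)
open Hypergraph public

IsUniform : ℕ → Hypergraph → Set
IsUniform k H = All (λ e → ∣ e ∣ ≡ k) (edges H) × Unique (edges H)

-- Vertices of ILTH(H): Fin (n + n); old vertex y is y (first block),
-- its clone y' is raise n y (second block).
embed : ∀ {n} → Subset n → Subset (n + n)
embed {n} e = e ++ᵥ replicate n false

cloneEdge : ∀ {n} → Subset n → Fin n → Subset (n + n)
cloneEdge e y = (e [ y ]≔ outside) ++ᵥ ⁅ y ⁆

ILTH : Hypergraph → Hypergraph
ILTH (hyp n E) =
  hyp (n + n)
      (map embed E ++ concatMap (λ e → map (cloneEdge e) (filter (_∈? e) (allFin n))) E)

ILTH^ : ℕ → Hypergraph → Hypergraph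
ILTH^ ℕ.zero H = H
ILTH^ (ℕ.suc t) H = ILTH (ILTH^ t H)

CardVec : Set
CardVec = Vec ℕ 7

cardVec : ∀ {n} → Subset n → Subset n → Subset n → CardVec
cardVec e1 e2 e3 =
    ∣ e1 ∩ ∁ (e2 ∪ e3) ∣
  ∷ ∣ e2 ∩ ∁ (e1 ∪ e3) ∣
  ∷ ∣ e3 ∩ ∁ (e1 ∪ e2) ∣
  ∷ ∣ (e1 ∩ e2) ∩ ∁ e3 ∣
  ∷ ∣ (e2 ∩ e3) ∩ ∁ e1 ∣
  ∷ ∣ (e1 ∩ e3) ∩ ∁ e2 ∣
  ∷ ∣ e1 ∩ (e2 ∩ e3) ∣
  ∷ []

_≟S_ : ∀ {m} → DecidableEquality (Subset m)
_≟S_ = ≡-dec _≟B_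

_≟V_ : DecidableEquality CardVec
_≟V_ = ≡-dec Data.Nat._≟_

motifCount : Hypergraph → CardVec → ℕ
motifCount H v =
  length (filter
    (λ { (i , j , l) →
         ¬? (E i ≟S E j) ×-dec ¬? (E j ≟S E l) ×-dec ¬? (E i ≟S E l)
           ×-dec (cardVec (E i) (E j) (E l) ≟V v) })
    (cartesianProduct (allFin m) (cartesianProduct (allFin m) (allFin m))))
  where
    m = length (edges H)
    E : Fin m → Subset (n H)
    E = lookup (edges H)

module Submission where

-- Fix a motif (e₁, e₂, e₃) of H and pick in each eᵢ at most one vertex to be replaced by its
-- clone.  The resulting hyperedges of ILTH(H) have the same cardinality vector as long as the
-- choice is coherent (a vertex cloned in one eᵢ is cloned in every eᵢ containing it): each
-- cloned vertex then moves, in all edges at once, from the old half of the vertex set to the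
-- new one without changing the region it lies in.  The coherent choices are a vertex of
-- e₁ ∩ e₂ ∩ e₃ (g ways), a vertex lying in exactly two of the edges together with an optional
-- private vertex of the third ((c+1)d + (b+1)f + (a+1)e ways), or an optional private vertex
-- of each edge ((a+1)(b+1)(c+1) ways).  A cloned hyperedge determines both the original
-- hyperedge and the cloned vertex, so distinct pairs (motif, choice) give distinct motifs.

open import Defs
open import Data.Nat using (ℕ; _+_; _*_; _≤_; _≥_; suc)
open import Data.Vec using (_∷_; [])
open import Relation.Binary.PropositionalEquality using (_≡_)

open import Data.Nat using (z≤n; s≤s)
open import Data.Nat.Properties
  using (≤-trans; ≤-reflexive; +-assoc; +-identityʳ; +-commutativeSemigroup; module ≤-Reasoning)
open import Data.Nat.ListAction using (sum)
open import Data.Nat.Tactic.RingSolver using (solve-∀)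
open import Algebra.Properties.CommutativeSemigroup +-commutativeSemigroup
  using () renaming (interchange to +-interchange)
open import Data.Bool using (Bool; true; false; not; _∧_; _∨_; if_then_else_)
open import Data.Bool.Properties using (¬-not)
open import Data.Empty using (⊥-elim)
open import Data.Fin as Fin using (Fin) renaming (_≟_ to _≟ᶠ_)
open import Data.Fin.Properties using (suc-injective)
open import Data.Fin.Subset using (Subset; _∩_; _∪_; ∁; ∣_∣; ⁅_⁆; outside; ⊥)
open import Data.Fin.Subset.Properties using (x∈⁅x⁆; x∈⁅y⁆⇒x≡y; _∈?_)
open import Data.List
  using (List; []; _∷_; length; map; filter; concatMap; cartesianProductWith; cartesianProduct; upTo; allFin; _++_)
import Data.List as List
open import Data.List.Properties
  using (length-++; length-map; map-++; map-∘; map-cong; length-removeAt′; map-tabulate; tabulate-lookup)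
open import Data.List.Membership.Propositional using (_∈_; _─_; find)
open import Data.List.Membership.Propositional.Properties
  using (∈-concatMap⁻; ∈-concatMap⁺; ∈-map⁺; ∈-map⁻; ∈-++⁺ˡ; ∈-++⁺ʳ; ∈-filter⁺; ∈-filter⁻;
         ∈-allFin; ∈-cartesianProduct⁺; ∈-cartesianProduct⁻)
open import Data.List.Relation.Binary.Disjoint.Propositional using (Disjoint)
open import Data.List.Relation.Unary.All as All using (All; []; _∷_)
import Data.List.Relation.Unary.All.Properties as All
open import Data.List.Relation.Unary.Any as Any using (here; there; index)
open import Data.List.Relation.Unary.Unique.Propositional using (Unique; []; _∷_)
import Data.List.Relation.Unary.Unique.Propositional.Properties as Unique
open import Data.Maybe using (Maybe; nothing; just)
open import Data.Maybe.Properties using (just-injective) renaming (≡-dec to ≡-decᵐ)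
open import Data.Product using (_×_; _,_; proj₁; proj₂; ∃)
import Data.Product as Product
open import Data.Sum using (_⊎_; inj₁; inj₂)
open import Data.Unit using (tt)
open import Data.Vec using (Vec; lookup; zipWith; _[_]≔_) renaming (_++_ to _++ᵥ_)
open import Data.Vec.Properties
  using (zipWith-assoc; zipWith-identityʳ; tabulate∘lookup; tabulate-cong; lookup-zipWith; lookup-map;
         lookup-replicate; lookup∘update; lookup∘update′; []=⇒lookup; lookup⇒[]=;
         ++-injectiveˡ; ++-injectiveʳ)
open import Function using (_∘_; id)
open import Relation.Binary.PropositionalEquality using (_≢_; refl; sym; trans; cong; cong₂; module ≡-Reasoning)
open import Relation.Nullary using (¬?; Dec; yes; no; does)
open import Relation.Nullary.Decidable using (_×-dec_; _⊎-dec_)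
open import Relation.Unary using (Decidable)

private variable
  A B C D : Set

∈-─ : ∀ {x z : A} {ys} (x∈ys : x ∈ ys) → z ∈ ys → z ≢ x → z ∈ ys ─ x∈ys
∈-─ (here refl) (here refl) z≢x = ⊥-elim (z≢x refl)
∈-─ (here refl) (there z∈ys) _  = z∈ys
∈-─ (there x∈ys) (here refl) _  = here refl
∈-─ (there x∈ys) (there z∈ys) z≢x = there (∈-─ x∈ys z∈ys z≢x)

Unique-⊆⇒length≤ : ∀ {xs ys : List A} → Unique xs → All (_∈ ys) xs → length xs ≤ length ys
Unique-⊆⇒length≤ [] [] = z≤n
Unique-⊆⇒length≤ {xs = x ∷ xs} {ys} (x∉xs ∷ xs-unique) (x∈ys ∷ xs⊆ys) =
  ≤-trans (s≤s (Unique-⊆⇒length≤ xs-unique xs⊆ys─x))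
          (≤-reflexive (sym (length-removeAt′ ys (index x∈ys))))
  where
  xs⊆ys─x : All (_∈ ys ─ x∈ys) xs
  xs⊆ys─x = All.zipWith (λ (z∈ys , x≢z) → ∈-─ x∈ys z∈ys (x≢z ∘ sym)) (xs⊆ys , x∉xs)

Unique-map⁺-on : ∀ {P : A → Set} (f : A → B) {xs} →
                 (∀ {x y} → P x → P y → f x ≡ f y → x ≡ y) →
                 All P xs → Unique xs → Unique (map f xs)
Unique-map⁺-on f inj [] [] = []
Unique-map⁺-on f inj (px ∷ pxs) (x∉xs ∷ xs-unique) =
  All.map⁺ (All.zipWith (λ (py , x≢y) fx≡fy → x≢y (inj px py fx≡fy)) (pxs , x∉xs))
  ∷ Unique-map⁺-on f inj pxs xs-unique

Unique-concatMap⁺ : ∀ (f : A → List B) {xs} →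
                    (∀ {x y z} → z ∈ f x → z ∈ f y → x ≡ y) →
                    All (Unique ∘ f) xs → Unique xs → Unique (concatMap f xs)
Unique-concatMap⁺ f sep [] [] = []
Unique-concatMap⁺ f {x ∷ xs} sep (fx-unique ∷ fxs-unique) (x∉xs ∷ xs-unique) =
  Unique.++⁺ fx-unique (Unique-concatMap⁺ f sep fxs-unique xs-unique) disjoint
  where
  disjoint : Disjoint (f x) (concatMap f xs)
  disjoint (z∈fx , z∈fxs) with find (∈-concatMap⁻ f {xs = xs} z∈fxs)
  ... | y , y∈xs , z∈fy = All.lookup x∉xs y∈xs (sep z∈fx z∈fy)

All-cartesianProductWith⁺ : ∀ {P : A → Set} {Q : B → Set} {R : C → Set} (f : A → B → C) {xs ys} →
                            (∀ {x y} → P x → Q y → R (f x y)) →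
                            All P xs → All Q ys → All R (cartesianProductWith f xs ys)
All-cartesianProductWith⁺ f h [] qys = []
All-cartesianProductWith⁺ f h (px ∷ pxs) qys =
  All.++⁺ (All.map⁺ (All.map (h px) qys)) (All-cartesianProductWith⁺ f h pxs qys)

length-cartesianProductWith : ∀ (f : A → B → C) xs ys →
                              length (cartesianProductWith f xs ys) ≡ length xs * length ys
length-cartesianProductWith f [] ys = refl
length-cartesianProductWith f (x ∷ xs) ys = begin
  length (map (f x) ys ++ cartesianProductWith f xs ys)
    ≡⟨ length-++ (map (f x) ys) ⟩
  length (map (f x) ys) + length (cartesianProductWith f xs ys)
    ≡⟨ cong₂ _+_ (length-map (f x) ys) (length-cartesianProductWith f xs ys) ⟩
  length ys + length xs * length ys
    ∎
  where open ≡-Reasoning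

length-concatMap : ∀ (f : A → List B) xs → length (concatMap f xs) ≡ sum (map (length ∘ f) xs)
length-concatMap f [] = refl
length-concatMap f (x ∷ xs) =
  trans (length-++ (f x)) (cong (length (f x) +_) (length-concatMap f xs))

length-concatMap-const : ∀ (f : A → List B) {k} xs →
                         All (λ x → length (f x) ≡ k) xs → length (concatMap f xs) ≡ length xs * k
length-concatMap-const f [] [] = refl
length-concatMap-const f (x ∷ xs) (fx≡k ∷ fxs≡k) =
  trans (length-++ (f x)) (cong₂ _+_ fx≡k (length-concatMap-const f xs fxs≡k))

filter-map : ∀ {P : B → Set} (P? : Decidable P) (f : A → B) xs →
             filter P? (map f xs) ≡ map f (filter (P? ∘ f) xs)
filter-map P? f [] = refl
filter-map P? f (x ∷ xs) with does (P? (f x))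
... | true  = cong (f x ∷_) (filter-map P? f xs)
... | false = filter-map P? f xs

map-cartesianProduct : ∀ (f : A → C) (g : B → D) xs ys →
                       map (Product.map f g) (cartesianProduct xs ys) ≡ cartesianProduct (map f xs) (map g ys)
map-cartesianProduct f g [] ys = refl
map-cartesianProduct f g (x ∷ xs) ys = begin
  map (Product.map f g) (map (x ,_) ys ++ cartesianProduct xs ys)
    ≡⟨ map-++ (Product.map f g) (map (x ,_) ys) (cartesianProduct xs ys) ⟩
  map (Product.map f g) (map (x ,_) ys) ++ map (Product.map f g) (cartesianProduct xs ys)
    ≡⟨ cong₂ _++_ (trans (sym (map-∘ ys)) (map-∘ ys)) (map-cartesianProduct f g xs ys) ⟩
  map (f x ,_) (map g ys) ++ cartesianProduct (map f xs) (map g ys)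
    ∎
  where open ≡-Reasoning

-- Cardinality vectors

infixl 6 _⊕_

_⊕_ : ∀ {m} → Vec ℕ m → Vec ℕ m → Vec ℕ m
_⊕_ = zipWith _+_

⊕-interchange : ∀ {m} (u v w x : Vec ℕ m) → (u ⊕ v) ⊕ (w ⊕ x) ≡ (u ⊕ w) ⊕ (v ⊕ x)
⊕-interchange []      []      []      []      = refl
⊕-interchange (a ∷ u) (b ∷ v) (c ∷ w) (d ∷ x) =
  cong₂ _∷_ (+-interchange a b c d) (⊕-interchange u v w x)

cardVec₁ : Bool → Bool → Bool → CardVec
cardVec₁ x y z = cardVec (x ∷ []) (y ∷ []) (z ∷ [])

cardVec-∷ : ∀ {m} x y z (xs ys zs : Subset m) →
            cardVec (x ∷ xs) (y ∷ ys) (z ∷ zs) ≡ cardVec₁ x y z ⊕ cardVec xs ys zs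
cardVec-∷ true  true  true  _ _ _ = refl
cardVec-∷ true  true  false _ _ _ = refl
cardVec-∷ true  false true  _ _ _ = refl
cardVec-∷ true  false false _ _ _ = refl
cardVec-∷ false true  true  _ _ _ = refl
cardVec-∷ false true  false _ _ _ = refl
cardVec-∷ false false true  _ _ _ = refl
cardVec-∷ false false false _ _ _ = refl

cardVec-++ : ∀ {m k} (u₁ u₂ u₃ : Subset m) (v₁ v₂ v₃ : Subset k) →
             cardVec (u₁ ++ᵥ v₁) (u₂ ++ᵥ v₂) (u₃ ++ᵥ v₃)
             ≡ cardVec u₁ u₂ u₃ ⊕ cardVec v₁ v₂ v₃
cardVec-++ [] [] [] v₁ v₂ v₃ = refl
cardVec-++ (x ∷ u₁) (y ∷ u₂) (z ∷ u₃) v₁ v₂ v₃ = begin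
  cardVec (x ∷ u₁ ++ᵥ v₁) (y ∷ u₂ ++ᵥ v₂) (z ∷ u₃ ++ᵥ v₃)
    ≡⟨ cardVec-∷ x y z (u₁ ++ᵥ v₁) (u₂ ++ᵥ v₂) (u₃ ++ᵥ v₃) ⟩
  cardVec₁ x y z ⊕ cardVec (u₁ ++ᵥ v₁) (u₂ ++ᵥ v₂) (u₃ ++ᵥ v₃)
    ≡⟨ cong (cardVec₁ x y z ⊕_) (cardVec-++ u₁ u₂ u₃ v₁ v₂ v₃) ⟩
  cardVec₁ x y z ⊕ (cardVec u₁ u₂ u₃ ⊕ cardVec v₁ v₂ v₃)
    ≡⟨ zipWith-assoc {f = _+_} +-assoc (cardVec₁ x y z) (cardVec u₁ u₂ u₃) (cardVec v₁ v₂ v₃) ⟨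
  cardVec₁ x y z ⊕ cardVec u₁ u₂ u₃ ⊕ cardVec v₁ v₂ v₃
    ≡⟨ cong (_⊕ cardVec v₁ v₂ v₃) (cardVec-∷ x y z u₁ u₂ u₃) ⟨
  cardVec (x ∷ u₁) (y ∷ u₂) (z ∷ u₃) ⊕ cardVec v₁ v₂ v₃
    ∎
  where open ≡-Reasoning

Stays Moves : (x u s : Bool) → Set
Stays x u s = u ≡ x × s ≡ false
Moves x u s = u ≡ false × s ≡ x

Splits : (x₁ u₁ s₁ x₂ u₂ s₂ x₃ u₃ s₃ : Bool) → Set
Splits x₁ u₁ s₁ x₂ u₂ s₂ x₃ u₃ s₃ =
    (Stays x₁ u₁ s₁ × Stays x₂ u₂ s₂ × Stays x₃ u₃ s₃)
  ⊎ (Moves x₁ u₁ s₁ × Moves x₂ u₂ s₂ × Moves x₃ u₃ s₃)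

cardVec₁-split : ∀ {x₁ u₁ s₁ x₂ u₂ s₂ x₃ u₃ s₃} → Splits x₁ u₁ s₁ x₂ u₂ s₂ x₃ u₃ s₃ →
                 cardVec₁ u₁ u₂ u₃ ⊕ cardVec₁ s₁ s₂ s₃ ≡ cardVec₁ x₁ x₂ x₃
cardVec₁-split (inj₁ ((refl , refl) , (refl , refl) , (refl , refl))) =
  zipWith-identityʳ {f = _+_} {e = 0} +-identityʳ _
cardVec₁-split (inj₂ ((refl , refl) , (refl , refl) , (refl , refl))) = refl

cardVec-split : ∀ {m} (x₁ u₁ s₁ x₂ u₂ s₂ x₃ u₃ s₃ : Subset m) →
                (∀ j → Splits (lookup x₁ j) (lookup u₁ j) (lookup s₁ j)
                              (lookup x₂ j) (lookup u₂ j) (lookup s₂ j)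
                              (lookup x₃ j) (lookup u₃ j) (lookup s₃ j)) →
                cardVec u₁ u₂ u₃ ⊕ cardVec s₁ s₂ s₃ ≡ cardVec x₁ x₂ x₃
cardVec-split [] [] [] [] [] [] [] [] [] _ = refl
cardVec-split (x₁ ∷ X₁) (u₁ ∷ U₁) (s₁ ∷ S₁) (x₂ ∷ X₂) (u₂ ∷ U₂) (s₂ ∷ S₂)
              (x₃ ∷ X₃) (u₃ ∷ U₃) (s₃ ∷ S₃) splits = begin
  cardVec (u₁ ∷ U₁) (u₂ ∷ U₂) (u₃ ∷ U₃) ⊕ cardVec (s₁ ∷ S₁) (s₂ ∷ S₂) (s₃ ∷ S₃)
    ≡⟨ cong₂ _⊕_ (cardVec-∷ u₁ u₂ u₃ U₁ U₂ U₃) (cardVec-∷ s₁ s₂ s₃ S₁ S₂ S₃) ⟩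
  (cardVec₁ u₁ u₂ u₃ ⊕ cardVec U₁ U₂ U₃) ⊕ (cardVec₁ s₁ s₂ s₃ ⊕ cardVec S₁ S₂ S₃)
    ≡⟨ ⊕-interchange (cardVec₁ u₁ u₂ u₃) (cardVec U₁ U₂ U₃) (cardVec₁ s₁ s₂ s₃) _ ⟩
  (cardVec₁ u₁ u₂ u₃ ⊕ cardVec₁ s₁ s₂ s₃) ⊕ (cardVec U₁ U₂ U₃ ⊕ cardVec S₁ S₂ S₃)
    ≡⟨ cong₂ _⊕_ (cardVec₁-split (splits Fin.zero))
                 (cardVec-split X₁ U₁ S₁ X₂ U₂ S₂ X₃ U₃ S₃ (splits ∘ Fin.suc)) ⟩
  cardVec₁ x₁ x₂ x₃ ⊕ cardVec X₁ X₂ X₃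
    ≡⟨ cardVec-∷ x₁ x₂ x₃ X₁ X₂ X₃ ⟨
  cardVec (x₁ ∷ X₁) (x₂ ∷ X₂) (x₃ ∷ X₃)
    ∎
  where open ≡-Reasoning

-- Cloning one vertex of a hyperedge

keptPart : ∀ {m} → Subset m → Maybe (Fin m) → Subset m
keptPart e nothing  = e
keptPart e (just y) = e [ y ]≔ outside

clonePart : ∀ {m} → Maybe (Fin m) → Subset m
clonePart nothing  = ⊥
clonePart (just y) = ⁅ y ⁆

-- clone e nothing is definitionally embed e, and clone e (just y) is cloneEdge e y.
clone : ∀ {m} → Subset m → Maybe (Fin m) → Subset (m + m)
clone e w = keptPart e w ++ᵥ clonePart w

Clonable : ∀ {m} → Subset m → Maybe (Fin m) → Set
Clonable e w = ∀ {y} → w ≡ just y → lookup e y ≡ true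

_≟ᵐ_ : ∀ {m} (w w′ : Maybe (Fin m)) → Dec (w ≡ w′)
_≟ᵐ_ = ≡-decᵐ _≟ᶠ_

clonePart-just : ∀ {m} (y : Fin m) → lookup (clonePart (just y)) y ≡ true
clonePart-just y = []=⇒lookup (x∈⁅x⁆ y)

clonePart-member : ∀ {m} {w} {j : Fin m} → lookup (clonePart w) j ≡ true → w ≡ just j
clonePart-member {w = nothing} {j} j∈⊥ with () ← trans (sym (lookup-replicate j false)) j∈⊥
clonePart-member {w = just y} {j} j∈⁅y⁆ =
  cong just (sym (x∈⁅y⁆⇒x≡y y (lookup⇒[]= j ⁅ y ⁆ j∈⁅y⁆)))

clonePart-injective : ∀ {m} {w w′ : Maybe (Fin m)} → clonePart w ≡ clonePart w′ → w ≡ w′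
clonePart-injective {w = nothing} {nothing} _ = refl
clonePart-injective {w = nothing} {just y′} eq =
  clonePart-member (trans (cong (λ s → lookup s y′) eq) (clonePart-just y′))
clonePart-injective {w = just y} eq =
  sym (clonePart-member (trans (cong (λ s → lookup s y) (sym eq)) (clonePart-just y)))

lookup-clone-untouched : ∀ {m} {e : Subset m} {w j} → w ≢ just j →
                         Stays (lookup e j) (lookup (keptPart e w) j) (lookup (clonePart w) j)
lookup-clone-untouched {w = nothing} w≢j = refl , ¬-not (w≢j ∘ clonePart-member)
lookup-clone-untouched {e = e} {just y} w≢j =
  lookup∘update′ (w≢j ∘ cong just ∘ sym) e false , ¬-not (w≢j ∘ clonePart-member)

lookup-clone-moved : ∀ {m} {e : Subset m} {w j} → Clonable e w → (lookup e j ≡ true → w ≡ just j) →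
                     Moves (lookup e j) (lookup (keptPart e w) j) (lookup (clonePart w) j)
lookup-clone-moved {e = e} {w} {j} clonable covered with w ≟ᵐ just j
... | yes refl = lookup∘update j e false , trans (clonePart-just j) (sym (clonable refl))
... | no w≢j with lookup-clone-untouched {e = e} w≢j | ¬-not (w≢j ∘ covered)
...   | kept≡ , clone≡false | ej≡false = trans kept≡ ej≡false , trans clone≡false (sym ej≡false)

lookup-ext : ∀ {m} {xs ys : Vec A m} → (∀ j → lookup xs j ≡ lookup ys j) → xs ≡ ys
lookup-ext {xs = xs} {ys} eq = trans (sym (tabulate∘lookup xs)) (trans (tabulate-cong eq) (tabulate∘lookup ys))

clone-injectiveʳ : ∀ {m} {e e′ : Subset m} {w w′} → clone e w ≡ clone e′ w′ → w ≡ w′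
clone-injectiveʳ {e = e} {e′} {w} {w′} eq =
  clonePart-injective (++-injectiveʳ (keptPart e w) (keptPart e′ w′) eq)

clone-injective : ∀ {m} {e e′ : Subset m} {w w′} → Clonable e w → Clonable e′ w′ →
                  clone e w ≡ clone e′ w′ → e ≡ e′ × w ≡ w′
clone-injective {e = e} {e′} {w} {w′} clonable clonable′ eq = lookup-ext same , w≡w′
  where
  w≡w′ : w ≡ w′
  w≡w′ = clone-injectiveʳ eq
  kept≡ : keptPart e w ≡ keptPart e′ w′
  kept≡ = ++-injectiveˡ (keptPart e w) (keptPart e′ w′) eq
  same : ∀ j → lookup e j ≡ lookup e′ j
  same j with w ≟ᵐ just j
  ... | yes w≡j = trans (clonable w≡j) (sym (clonable′ (trans (sym w≡w′) w≡j)))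
  ... | no w≢j  = begin
    lookup e j                ≡⟨ proj₁ (lookup-clone-untouched {e = e} w≢j) ⟨
    lookup (keptPart e w) j   ≡⟨ cong (λ s → lookup s j) kept≡ ⟩
    lookup (keptPart e′ w′) j ≡⟨ proj₁ (lookup-clone-untouched {e = e′} (w≢j ∘ trans w≡w′)) ⟩
    lookup e′ j               ∎
    where open ≡-Reasoning

elements : ∀ {m} → Subset m → List (Fin m)
elements []           = []
elements (true ∷ p)   = Fin.zero ∷ map Fin.suc (elements p)
elements (false ∷ p)  = map Fin.suc (elements p)

length-elements : ∀ {m} (p : Subset m) → length (elements p) ≡ ∣ p ∣
length-elements []          = refl
length-elements (true ∷ p)  = cong suc (trans (length-map Fin.suc (elements p)) (length-elements p))
length-elements (false ∷ p) = trans (length-map Fin.suc (elements p)) (length-elements p)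

elements-∈ : ∀ {m} (p : Subset m) → All (λ y → lookup p y ≡ true) (elements p)
elements-∈ []          = []
elements-∈ (true ∷ p)  = refl ∷ All.map⁺ (elements-∈ p)
elements-∈ (false ∷ p) = All.map⁺ (elements-∈ p)

elements-unique : ∀ {m} (p : Subset m) → Unique (elements p)
elements-unique []          = []
elements-unique (true ∷ p)  =
  All.map⁺ (All.universal (λ _ ()) _) ∷ Unique.map⁺ suc-injective (elements-unique p)
elements-unique (false ∷ p) = Unique.map⁺ suc-injective (elements-unique p)

optElements : ∀ {m} → Subset m → List (Maybe (Fin m))
optElements p = nothing ∷ map just (elements p)

length-optElements : ∀ {m} (p : Subset m) → length (optElements p) ≡ suc ∣ p ∣
length-optElements p = cong suc (trans (length-map just (elements p)) (length-elements p))

optElements-unique : ∀ {m} (p : Subset m) → Unique (optElements p)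
optElements-unique p = All.map⁺ (All.universal (λ _ ()) _) ∷ Unique.map⁺ just-injective (elements-unique p)

lookup-∩ : ∀ {m} (p q : Subset m) y → lookup (p ∩ q) y ≡ lookup p y ∧ lookup q y
lookup-∩ p q y = lookup-zipWith _∧_ y p q

lookup-∪ : ∀ {m} (p q : Subset m) y → lookup (p ∪ q) y ≡ lookup p y ∨ lookup q y
lookup-∪ p q y = lookup-zipWith _∨_ y p q

lookup-∁ : ∀ {m} (p : Subset m) y → lookup (∁ p) y ≡ not (lookup p y)
lookup-∁ p y = lookup-map y not p

∧-not-∨-true : ∀ x y z → x ∧ not (y ∨ z) ≡ true → x ≡ true × y ≡ false × z ≡ false
∧-not-∨-true true  false false _ = refl , refl , refl
∧-not-∨-true true  true  _     ()
∧-not-∨-true true  false true  ()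
∧-not-∨-true false _     _     ()

∧-∧-not-true : ∀ x y z → (x ∧ y) ∧ not z ≡ true → x ≡ true × y ≡ true × z ≡ false
∧-∧-not-true true  true  false _ = refl , refl , refl
∧-∧-not-true true  true  true  ()
∧-∧-not-true true  false _     ()
∧-∧-not-true false _     _     ()

∧-∧-true : ∀ x y z → x ∧ (y ∧ z) ≡ true → x ≡ true × y ≡ true × z ≡ true
∧-∧-true true  true  true  _ = refl , refl , refl
∧-∧-true true  true  false ()
∧-∧-true true  false _     ()
∧-∧-true false _     _     ()

∈-∩∁∪ : ∀ {m} (p q r : Subset m) y → lookup (p ∩ ∁ (q ∪ r)) y ≡ true →
        lookup p y ≡ true × lookup q y ≡ false × lookup r y ≡ false
∈-∩∁∪ p q r y rewrite lookup-∩ p (∁ (q ∪ r)) y | lookup-∁ (q ∪ r) y | lookup-∪ q r y =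
  ∧-not-∨-true _ _ _

∈-∩∩∁ : ∀ {m} (p q r : Subset m) y → lookup ((p ∩ q) ∩ ∁ r) y ≡ true →
        lookup p y ≡ true × lookup q y ≡ true × lookup r y ≡ false
∈-∩∩∁ p q r y rewrite lookup-∩ (p ∩ q) (∁ r) y | lookup-∩ p q y | lookup-∁ r y =
  ∧-∧-not-true _ _ _

∈-∩∩ : ∀ {m} (p q r : Subset m) y → lookup (p ∩ (q ∩ r)) y ≡ true →
       lookup p y ≡ true × lookup q y ≡ true × lookup r y ≡ true
∈-∩∩ p q r y rewrite lookup-∩ p (q ∩ r) y | lookup-∩ q r y = ∧-∧-true _ _ _

-- Coherent clonings of a triple of hyperedges

weight : CardVec → ℕ
weight (a ∷ b ∷ c ∷ d ∷ e ∷ f ∷ g ∷ []) = g + suc c * d + suc b * f + suc a * e + suc a * suc b * suc c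

data Choice (m : ℕ) : Set where
  all₁₂₃               : Fin m → Choice m
  both₁₂ both₁₃ both₂₃ : Fin m → Maybe (Fin m) → Choice m
  each                 : Maybe (Fin m) → Maybe (Fin m) → Maybe (Fin m) → Choice m

cloned₁ cloned₂ cloned₃ : ∀ {m} → Choice m → Maybe (Fin m)
cloned₁ (all₁₂₃ y)   = just y
cloned₁ (both₁₂ y _) = just y
cloned₁ (both₁₃ y _) = just y
cloned₁ (both₂₃ _ w) = w
cloned₁ (each w _ _) = w
cloned₂ (all₁₂₃ y)   = just y
cloned₂ (both₁₂ y _) = just y
cloned₂ (both₁₃ _ w) = w
cloned₂ (both₂₃ y _) = just y
cloned₂ (each _ w _) = w
cloned₃ (all₁₂₃ y)   = just y
cloned₃ (both₁₂ _ w) = w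
cloned₃ (both₁₃ y _) = just y
cloned₃ (both₂₃ y _) = just y
cloned₃ (each _ _ w) = w

kind : ∀ {m} → Choice m → ℕ
kind (all₁₂₃ _)   = 0
kind (both₁₂ _ _) = 1
kind (both₁₃ _ _) = 2
kind (both₂₃ _ _) = 3
kind (each _ _ _) = 4

module Cloning {m} (e₁ e₂ e₃ : Subset m) where

  Touches : Maybe (Fin m) → Maybe (Fin m) → Maybe (Fin m) → Fin m → Set
  Touches w₁ w₂ w₃ j = w₁ ≡ just j ⊎ w₂ ≡ just j ⊎ w₃ ≡ just j

  Covers : Maybe (Fin m) → Maybe (Fin m) → Maybe (Fin m) → Fin m → Set
  Covers w₁ w₂ w₃ j = (lookup e₁ j ≡ true → w₁ ≡ just j)
                    × (lookup e₂ j ≡ true → w₂ ≡ just j)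
                    × (lookup e₃ j ≡ true → w₃ ≡ just j)

  Coherent : Maybe (Fin m) → Maybe (Fin m) → Maybe (Fin m) → Set
  Coherent w₁ w₂ w₃ = ∀ {j} → Touches w₁ w₂ w₃ j → Covers w₁ w₂ w₃ j

  cardVec-clone : ∀ {w₁ w₂ w₃} → Clonable e₁ w₁ → Clonable e₂ w₂ → Clonable e₃ w₃ →
                  Coherent w₁ w₂ w₃ →
                  cardVec (clone e₁ w₁) (clone e₂ w₂) (clone e₃ w₃) ≡ cardVec e₁ e₂ e₃
  cardVec-clone {w₁} {w₂} {w₃} clonable₁ clonable₂ clonable₃ coherent =
    trans (cardVec-++ (keptPart e₁ w₁) (keptPart e₂ w₂) (keptPart e₃ w₃)
                      (clonePart w₁) (clonePart w₂) (clonePart w₃))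
          (cardVec-split e₁ (keptPart e₁ w₁) (clonePart w₁) e₂ (keptPart e₂ w₂) (clonePart w₂)
                         e₃ (keptPart e₃ w₃) (clonePart w₃) splits)
    where
    splits : ∀ j → Splits (lookup e₁ j) (lookup (keptPart e₁ w₁) j) (lookup (clonePart w₁) j)
                          (lookup e₂ j) (lookup (keptPart e₂ w₂) j) (lookup (clonePart w₂) j)
                          (lookup e₃ j) (lookup (keptPart e₃ w₃) j) (lookup (clonePart w₃) j)
    splits j with (w₁ ≟ᵐ just j) ⊎-dec (w₂ ≟ᵐ just j) ⊎-dec (w₃ ≟ᵐ just j)
    ... | yes touches = let (covers₁ , covers₂ , covers₃) = coherent touches in
      inj₂ (lookup-clone-moved clonable₁ covers₁ ,
            lookup-clone-moved clonable₂ covers₂ ,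
            lookup-clone-moved clonable₃ covers₃)
    ... | no untouched =
      inj₁ (lookup-clone-untouched {e = e₁} (untouched ∘ inj₁) ,
            lookup-clone-untouched {e = e₂} (untouched ∘ inj₂ ∘ inj₁) ,
            lookup-clone-untouched {e = e₃} (untouched ∘ inj₂ ∘ inj₂))

  Pattern : Maybe (Fin m) → Bool → Bool → Bool → Set
  Pattern w p₁ p₂ p₃ =
    ∀ {y} → w ≡ just y → lookup e₁ y ≡ p₁ × lookup e₂ y ≡ p₂ × lookup e₃ y ≡ p₃

  Valid : Choice m → Set
  Valid (all₁₂₃ y)      = Pattern (just y) true true true
  Valid (both₁₂ y w)    = Pattern (just y) true true false × Pattern w false false true
  Valid (both₁₃ y w)    = Pattern (just y) true false true × Pattern w false true false
  Valid (both₂₃ y w)    = Pattern (just y) false true true × Pattern w true false false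
  Valid (each w₁ w₂ w₃) =
    Pattern w₁ true false false × Pattern w₂ false true false × Pattern w₃ false false true

  clonable₁ : ∀ {w p₂ p₃} → Pattern w true p₂ p₃ → Clonable e₁ w
  clonable₁ pat eq = proj₁ (pat eq)

  clonable₂ : ∀ {w p₁ p₃} → Pattern w p₁ true p₃ → Clonable e₂ w
  clonable₂ pat eq = proj₁ (proj₂ (pat eq))

  clonable₃ : ∀ {w p₁ p₂} → Pattern w p₁ p₂ true → Clonable e₃ w
  clonable₃ pat eq = proj₂ (proj₂ (pat eq))

  ClonableChoice : Choice m → Set
  ClonableChoice c = Clonable e₁ (cloned₁ c) × Clonable e₂ (cloned₂ c) × Clonable e₃ (cloned₃ c)

  valid⇒clonable : ∀ c → Valid c → ClonableChoice c
  valid⇒clonable (all₁₂₃ y)    py             = clonable₁ py , clonable₂ py , clonable₃ py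
  valid⇒clonable (both₁₂ y w)  (py , pw)      = clonable₁ py , clonable₂ py , clonable₃ pw
  valid⇒clonable (both₁₃ y w)  (py , pw)      = clonable₁ py , clonable₂ pw , clonable₃ py
  valid⇒clonable (both₂₃ y w)  (py , pw)      = clonable₁ pw , clonable₂ py , clonable₃ py
  valid⇒clonable (each _ _ _)  (p₁ , p₂ , p₃) = clonable₁ p₁ , clonable₂ p₂ , clonable₃ p₃

  covers : ∀ {w w₁ w₂ w₃ j p₁ p₂ p₃} → Pattern w p₁ p₂ p₃ → w ≡ just j →
           (p₁ ≡ true → w₁ ≡ just j) → (p₂ ≡ true → w₂ ≡ just j) →
           (p₃ ≡ true → w₃ ≡ just j) → Covers w₁ w₂ w₃ j
  covers pat w≡j k₁ k₂ k₃ with pat w≡j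
  ... | l₁ , l₂ , l₃ = k₁ ∘ trans (sym l₁) , k₂ ∘ trans (sym l₂) , k₃ ∘ trans (sym l₃)

  valid⇒coherent : ∀ c → Valid c → Coherent (cloned₁ c) (cloned₂ c) (cloned₃ c)
  valid⇒coherent (all₁₂₃ y) py (inj₁ eq)        = covers py eq (λ _ → eq) (λ _ → eq) (λ _ → eq)
  valid⇒coherent (all₁₂₃ y) py (inj₂ (inj₁ eq)) = covers py eq (λ _ → eq) (λ _ → eq) (λ _ → eq)
  valid⇒coherent (all₁₂₃ y) py (inj₂ (inj₂ eq)) = covers py eq (λ _ → eq) (λ _ → eq) (λ _ → eq)
  valid⇒coherent (both₁₂ y w) (py , pw) (inj₁ eq)        = covers py eq (λ _ → eq) (λ _ → eq) (λ ())
  valid⇒coherent (both₁₂ y w) (py , pw) (inj₂ (inj₁ eq)) = covers py eq (λ _ → eq) (λ _ → eq) (λ ())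
  valid⇒coherent (both₁₂ y w) (py , pw) (inj₂ (inj₂ eq)) = covers pw eq (λ ()) (λ ()) (λ _ → eq)
  valid⇒coherent (both₁₃ y w) (py , pw) (inj₁ eq)        = covers py eq (λ _ → eq) (λ ()) (λ _ → eq)
  valid⇒coherent (both₁₃ y w) (py , pw) (inj₂ (inj₁ eq)) = covers pw eq (λ ()) (λ _ → eq) (λ ())
  valid⇒coherent (both₁₃ y w) (py , pw) (inj₂ (inj₂ eq)) = covers py eq (λ _ → eq) (λ ()) (λ _ → eq)
  valid⇒coherent (both₂₃ y w) (py , pw) (inj₁ eq)        = covers pw eq (λ _ → eq) (λ ()) (λ ())
  valid⇒coherent (both₂₃ y w) (py , pw) (inj₂ (inj₁ eq)) = covers py eq (λ ()) (λ _ → eq) (λ _ → eq)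
  valid⇒coherent (both₂₃ y w) (py , pw) (inj₂ (inj₂ eq)) = covers py eq (λ ()) (λ _ → eq) (λ _ → eq)
  valid⇒coherent (each _ _ _) (p₁ , _ , _) (inj₁ eq)        = covers p₁ eq (λ _ → eq) (λ ()) (λ ())
  valid⇒coherent (each _ _ _) (_ , p₂ , _) (inj₂ (inj₁ eq)) = covers p₂ eq (λ ()) (λ _ → eq) (λ ())
  valid⇒coherent (each _ _ _) (_ , _ , p₃) (inj₂ (inj₂ eq)) = covers p₃ eq (λ ()) (λ ()) (λ _ → eq)

  cardVec-cloned : ∀ c → Valid c →
                   cardVec (clone e₁ (cloned₁ c)) (clone e₂ (cloned₂ c)) (clone e₃ (cloned₃ c))
                   ≡ cardVec e₁ e₂ e₃
  cardVec-cloned c valid with valid⇒clonable c valid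
  ... | clonable₁ , clonable₂ , clonable₃ =
    cardVec-clone clonable₁ clonable₂ clonable₃ (valid⇒coherent c valid)

  regionA regionB regionC regionD regionE regionF regionG : Subset m
  regionA = e₁ ∩ ∁ (e₂ ∪ e₃)
  regionB = e₂ ∩ ∁ (e₁ ∪ e₃)
  regionC = e₃ ∩ ∁ (e₁ ∪ e₂)
  regionD = (e₁ ∩ e₂) ∩ ∁ e₃
  regionE = (e₂ ∩ e₃) ∩ ∁ e₁
  regionF = (e₁ ∩ e₃) ∩ ∁ e₂
  regionG = e₁ ∩ (e₂ ∩ e₃)

  inA : ∀ {y} → lookup regionA y ≡ true → Pattern (just y) true false false
  inA {y} y∈A refl = ∈-∩∁∪ e₁ e₂ e₃ y y∈A

  inB : ∀ {y} → lookup regionB y ≡ true → Pattern (just y) false true false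
  inB {y} y∈B refl with ∈-∩∁∪ e₂ e₁ e₃ y y∈B
  ... | l₂ , l₁ , l₃ = l₁ , l₂ , l₃

  inC : ∀ {y} → lookup regionC y ≡ true → Pattern (just y) false false true
  inC {y} y∈C refl with ∈-∩∁∪ e₃ e₁ e₂ y y∈C
  ... | l₃ , l₁ , l₂ = l₁ , l₂ , l₃

  inD : ∀ {y} → lookup regionD y ≡ true → Pattern (just y) true true false
  inD {y} y∈D refl = ∈-∩∩∁ e₁ e₂ e₃ y y∈D

  inE : ∀ {y} → lookup regionE y ≡ true → Pattern (just y) false true true
  inE {y} y∈E refl with ∈-∩∩∁ e₂ e₃ e₁ y y∈E
  ... | l₂ , l₃ , l₁ = l₁ , l₂ , l₃

  inF : ∀ {y} → lookup regionF y ≡ true → Pattern (just y) true false true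
  inF {y} y∈F refl with ∈-∩∩∁ e₁ e₃ e₂ y y∈F
  ... | l₁ , l₃ , l₂ = l₁ , l₂ , l₃

  inG : ∀ {y} → lookup regionG y ≡ true → Pattern (just y) true true true
  inG {y} y∈G refl = ∈-∩∩ e₁ e₂ e₃ y y∈G

  elements-pattern : ∀ {p₁ p₂ p₃} (R : Subset m) →
                     (∀ {y} → lookup R y ≡ true → Pattern (just y) p₁ p₂ p₃) →
                     All (λ y → Pattern (just y) p₁ p₂ p₃) (elements R)
  elements-pattern R inR = All.map inR (elements-∈ R)

  optElements-pattern : ∀ {p₁ p₂ p₃} (R : Subset m) →
                        (∀ {y} → lookup R y ≡ true → Pattern (just y) p₁ p₂ p₃) →
                        All (λ w → Pattern w p₁ p₂ p₃) (optElements R)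
  optElements-pattern R inR = (λ ()) ∷ All.map⁺ (elements-pattern R inR)

  section : ℕ → List (Choice m)
  section 0 = map all₁₂₃ (elements regionG)
  section 1 = cartesianProductWith both₁₂ (elements regionD) (optElements regionC)
  section 2 = cartesianProductWith both₁₃ (elements regionF) (optElements regionB)
  section 3 = cartesianProductWith both₂₃ (elements regionE) (optElements regionA)
  section 4 = cartesianProductWith (λ w₁ → Product.uncurry (each w₁))
                (optElements regionA) (cartesianProduct (optElements regionB) (optElements regionC))
  section _ = []

  choices : List (Choice m)
  choices = concatMap section (upTo 5)

  section-valid : ∀ k → All Valid (section k)
  section-valid 0 = All.map⁺ (elements-pattern regionG inG)
  section-valid 1 = All-cartesianProductWith⁺ both₁₂ _,_
                      (elements-pattern regionD inD) (optElements-pattern regionC inC)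
  section-valid 2 = All-cartesianProductWith⁺ both₁₃ _,_
                      (elements-pattern regionF inF) (optElements-pattern regionB inB)
  section-valid 3 = All-cartesianProductWith⁺ both₂₃ _,_
                      (elements-pattern regionE inE) (optElements-pattern regionA inA)
  section-valid 4 = All-cartesianProductWith⁺ _ _,_ (optElements-pattern regionA inA)
                      (All-cartesianProductWith⁺ _,_ _,_
                        (optElements-pattern regionB inB) (optElements-pattern regionC inC))
  section-valid (suc (suc (suc (suc (suc _))))) = []

  section-unique : ∀ k → Unique (section k)
  section-unique 0 = Unique.map⁺ (λ { refl → refl }) (elements-unique regionG)
  section-unique 1 = Unique.cartesianProductWith⁺ both₁₂ (λ { refl → refl , refl })
                       (elements-unique regionD) (optElements-unique regionC)
  section-unique 2 = Unique.cartesianProductWith⁺ both₁₃ (λ { refl → refl , refl })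
                       (elements-unique regionF) (optElements-unique regionB)
  section-unique 3 = Unique.cartesianProductWith⁺ both₂₃ (λ { refl → refl , refl })
                       (elements-unique regionE) (optElements-unique regionA)
  section-unique 4 = Unique.cartesianProductWith⁺ _ (λ { refl → refl , refl }) (optElements-unique regionA)
                       (Unique.cartesianProduct⁺ (optElements-unique regionB) (optElements-unique regionC))
  section-unique (suc (suc (suc (suc (suc _))))) = []

  section-kind : ∀ k → All (λ c → kind c ≡ k) (section k)
  section-kind 0 = All.map⁺ (All.universal (λ _ → refl) _)
  section-kind 1 = All-cartesianProductWith⁺ both₁₂ (λ _ _ → refl)
                     (All.universal (λ _ → tt) (elements regionD))
                     (All.universal (λ _ → tt) (optElements regionC))
  section-kind 2 = All-cartesianProductWith⁺ both₁₃ (λ _ _ → refl)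
                     (All.universal (λ _ → tt) (elements regionF))
                     (All.universal (λ _ → tt) (optElements regionB))
  section-kind 3 = All-cartesianProductWith⁺ both₂₃ (λ _ _ → refl)
                     (All.universal (λ _ → tt) (elements regionE))
                     (All.universal (λ _ → tt) (optElements regionA))
  section-kind 4 = All-cartesianProductWith⁺ _ (λ _ _ → refl)
                     (All.universal (λ _ → tt) (optElements regionA))
                     (All.universal (λ _ → tt) (cartesianProduct (optElements regionB) (optElements regionC)))
  section-kind (suc (suc (suc (suc (suc _))))) = []

  choices-valid : All Valid choices
  choices-valid = All.concat⁺ (All.map⁺ (All.universal section-valid (upTo 5)))

  choices-unique : Unique choices
  choices-unique =
    Unique-concatMap⁺ section same-kind (All.universal section-unique (upTo 5)) (Unique.upTo⁺ 5)
    where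
    same-kind : ∀ {k k′ c} → c ∈ section k → c ∈ section k′ → k ≡ k′
    same-kind {k} {k′} c∈k c∈k′ =
      trans (sym (All.lookup (section-kind k) c∈k)) (All.lookup (section-kind k′) c∈k′)

  sectionSize : ℕ → ℕ
  sectionSize 0 = ∣ regionG ∣
  sectionSize 1 = ∣ regionD ∣ * suc ∣ regionC ∣
  sectionSize 2 = ∣ regionF ∣ * suc ∣ regionB ∣
  sectionSize 3 = ∣ regionE ∣ * suc ∣ regionA ∣
  sectionSize 4 = suc ∣ regionA ∣ * (suc ∣ regionB ∣ * suc ∣ regionC ∣)
  sectionSize _ = 0

  section-length : ∀ k → length (section k) ≡ sectionSize k
  section-length 0 = trans (length-map all₁₂₃ (elements regionG)) (length-elements regionG)
  section-length 1 = trans (length-cartesianProductWith both₁₂ (elements regionD) (optElements regionC))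
                           (cong₂ _*_ (length-elements regionD) (length-optElements regionC))
  section-length 2 = trans (length-cartesianProductWith both₁₃ (elements regionF) (optElements regionB))
                           (cong₂ _*_ (length-elements regionF) (length-optElements regionB))
  section-length 3 = trans (length-cartesianProductWith both₂₃ (elements regionE) (optElements regionA))
                           (cong₂ _*_ (length-elements regionE) (length-optElements regionA))
  section-length 4 = trans (length-cartesianProductWith _ (optElements regionA)
                             (cartesianProduct (optElements regionB) (optElements regionC)))
                           (cong₂ _*_ (length-optElements regionA)
                             (trans (length-cartesianProductWith _,_ (optElements regionB) (optElements regionC))
                                    (cong₂ _*_ (length-optElements regionB) (length-optElements regionC))))
  section-length (suc (suc (suc (suc (suc _))))) = refl

  choices-length : length choices ≡ weight (cardVec e₁ e₂ e₃)
  choices-length = begin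
    length choices                        ≡⟨ length-concatMap section (upTo 5) ⟩
    sum (map (length ∘ section) (upTo 5)) ≡⟨ cong sum (map-cong section-length (upTo 5)) ⟩
    sum (map sectionSize (upTo 5))        ≡⟨ sum≡weight (∣ regionA ∣) (∣ regionB ∣) (∣ regionC ∣) (∣ regionD ∣)
                                                         (∣ regionE ∣) (∣ regionF ∣) (∣ regionG ∣) ⟩
    weight (cardVec e₁ e₂ e₃)             ∎
    where
    open ≡-Reasoning
    sum≡weight : ∀ a b c d e f g →
                 g + (d * suc c + (f * suc b + (e * suc a + (suc a * (suc b * suc c) + 0))))
                 ≡ g + suc c * d + suc b * f + suc a * e + suc a * suc b * suc c
    sum≡weight = solve-∀

  classify₂₃ : Maybe (Fin m) → Maybe (Fin m) → Maybe (Fin m) → Choice m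
  classify₂₃ w₁ nothing  w₃ = each w₁ nothing w₃
  classify₂₃ w₁ (just z) w₃ = if lookup e₃ z then both₂₃ z w₁ else each w₁ (just z) w₃

  classify : Maybe (Fin m) → Maybe (Fin m) → Maybe (Fin m) → Choice m
  classify nothing  w₂ w₃ = classify₂₃ nothing w₂ w₃
  classify (just y) w₂ w₃ with lookup e₂ y | lookup e₃ y
  ... | true  | true  = all₁₂₃ y
  ... | true  | false = both₁₂ y w₃
  ... | false | true  = both₁₃ y w₂
  ... | false | false = classify₂₃ (just y) w₂ w₃

  classify-private₁ : ∀ {w₁ w₂ w₃} → Pattern w₁ true false false →
                      classify w₁ w₂ w₃ ≡ classify₂₃ w₁ w₂ w₃
  classify-private₁ {nothing} _ = refl
  classify-private₁ {just y} p₁ with p₁ refl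
  ... | _ , l₂ , l₃ rewrite l₂ | l₃ = refl

  classify₂₃-private₂ : ∀ {w₁ w₂ w₃} → Pattern w₂ false true false →
                        classify₂₃ w₁ w₂ w₃ ≡ each w₁ w₂ w₃
  classify₂₃-private₂ {w₂ = nothing} _ = refl
  classify₂₃-private₂ {w₂ = just z} p₂ with p₂ refl
  ... | _ , _ , l₃ rewrite l₃ = refl

  classify-cloned : ∀ c → Valid c → classify (cloned₁ c) (cloned₂ c) (cloned₃ c) ≡ c
  classify-cloned (all₁₂₃ y) py with py refl
  ... | _ , l₂ , l₃ rewrite l₂ | l₃ = refl
  classify-cloned (both₁₂ y w) (py , _) with py refl
  ... | _ , l₂ , l₃ rewrite l₂ | l₃ = refl
  classify-cloned (both₁₃ y w) (py , _) with py refl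
  ... | _ , l₂ , l₃ rewrite l₂ | l₃ = refl
  classify-cloned (both₂₃ z w) (pz , pw) with pz refl
  ... | _ , _ , l₃ rewrite classify-private₁ {w₂ = just z} {just z} pw | l₃ = refl
  classify-cloned (each w₁ w₂ w₃) (p₁ , p₂ , _) =
    trans (classify-private₁ p₁) (classify₂₃-private₂ p₂)

  cloned-injective : ∀ {c c′} → Valid c → Valid c′ → cloned₁ c ≡ cloned₁ c′ →
                     cloned₂ c ≡ cloned₂ c′ → cloned₃ c ≡ cloned₃ c′ → c ≡ c′
  cloned-injective {c} {c′} valid valid′ eq₁ eq₂ eq₃ = begin
    c
      ≡⟨ classify-cloned c valid ⟨
    classify (cloned₁ c) (cloned₂ c) (cloned₃ c)
      ≡⟨ cong₂ (λ w₁ (w₂ , w₃) → classify w₁ w₂ w₃) eq₁ (cong₂ _,_ eq₂ eq₃) ⟩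
    classify (cloned₁ c′) (cloned₂ c′) (cloned₃ c′)
      ≡⟨ classify-cloned c′ valid′ ⟩
    c′
      ∎
    where open ≡-Reasoning

cloneEdges : ∀ {m} → Subset m → List (Subset (m + m))
cloneEdges {m} e = map (cloneEdge e) (filter (_∈? e) (allFin m))

clone-∈-ILTH : ∀ H {e w} → e ∈ edges H → Clonable e w → clone e w ∈ edges (ILTH H)
clone-∈-ILTH (hyp m E) {w = nothing} e∈E _ = ∈-++⁺ˡ (∈-map⁺ embed e∈E)
clone-∈-ILTH (hyp m E) {e} {just y} e∈E clonable =
  ∈-++⁺ʳ (map embed E) (∈-concatMap⁺ cloneEdges (Any.map (λ { refl → y∈clones }) e∈E))
  where
  y∈clones : cloneEdge e y ∈ cloneEdges e
  y∈clones = ∈-map⁺ (cloneEdge e) (∈-filter⁺ (_∈? e) (∈-allFin y) (lookup⇒[]= y e (clonable refl)))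

ILTH-unique : ∀ H → Unique (edges H) → Unique (edges (ILTH H))
ILTH-unique (hyp m E) E-unique =
  Unique.++⁺ (Unique.map⁺ embed-injective E-unique)
             (Unique-concatMap⁺ cloneEdges separated (All.universal cloneEdges-unique E) E-unique)
             embedded-not-cloned
  where
  embed-injective : ∀ {e e′ : Subset m} → embed e ≡ embed e′ → e ≡ e′
  embed-injective = proj₁ ∘ clone-injective {w = nothing} {w′ = nothing} (λ ()) (λ ())

  cloneEdges-unique : ∀ e → Unique (cloneEdges e)
  cloneEdges-unique e = Unique.map⁺ (just-injective ∘ clone-injectiveʳ)
                                    (Unique.filter⁺ (_∈? e) (Unique.allFin⁺ m))

  ∈-cloneEdges⁻ : ∀ {e z} → z ∈ cloneEdges e → ∃ λ y → Clonable e (just y) × z ≡ clone e (just y)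
  ∈-cloneEdges⁻ {e} z∈ with y , y∈ , refl ← ∈-map⁻ (cloneEdge e) z∈ =
    y , (λ { refl → []=⇒lookup (proj₂ (∈-filter⁻ (_∈? e) {xs = allFin m} y∈)) }) , refl

  separated : ∀ {e e′ z} → z ∈ cloneEdges e → z ∈ cloneEdges e′ → e ≡ e′
  separated {e} {e′} z∈ z∈′
    with _ , clonable , refl ← ∈-cloneEdges⁻ {e} z∈
       | _ , clonable′ , eq ← ∈-cloneEdges⁻ {e′} z∈′ =
    proj₁ (clone-injective clonable clonable′ eq)

  embedded-not-cloned : Disjoint (map embed E) (concatMap cloneEdges E)
  embedded-not-cloned (z∈embeds , z∈clones)
    with e₀ , _ , refl ← ∈-map⁻ embed z∈embeds
       | e , _ , z∈ ← find (∈-concatMap⁻ cloneEdges {xs = E} z∈clones)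
    with y , _ , eq ← ∈-cloneEdges⁻ {e} z∈
    with () ← clone-injectiveʳ {e = e₀} {e} {nothing} {just y} eq

ILTH^-unique : ∀ t H → Unique (edges H) → Unique (edges (ILTH^ t H))
ILTH^-unique 0       H unique = unique
ILTH^-unique (suc t) H unique = ILTH-unique (ILTH^ t H) (ILTH^-unique t H unique)

-- Counting motifs

Triple : ℕ → Set
Triple m = Subset m × Subset m × Subset m

triples : List A → List (A × A × A)
triples E = cartesianProduct E (cartesianProduct E E)

IsMotif : ∀ {m} → CardVec → Triple m → Set
IsMotif v (x , y , z) = x ≢ y × y ≢ z × x ≢ z × cardVec x y z ≡ v

isMotif? : ∀ {m} (v : CardVec) → Decidable (IsMotif {m} v)
isMotif? v (x , y , z) = ¬? (x ≟S y) ×-dec ¬? (y ≟S z) ×-dec ¬? (x ≟S z) ×-dec (cardVec x y z ≟V v)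

motifs : ∀ {m} → List (Subset m) → CardVec → List (Triple m)
motifs E v = filter (isMotif? v) (triples E)

∈-motifs⁻ : ∀ {m} {E : List (Subset m)} {v e₁ e₂ e₃} → (e₁ , e₂ , e₃) ∈ motifs E v →
            (e₁ ∈ E × e₂ ∈ E × e₃ ∈ E) × IsMotif v (e₁ , e₂ , e₃)
∈-motifs⁻ {E = E} {v} t∈ with t∈triples , motif ← ∈-filter⁻ (isMotif? v) {xs = triples E} t∈ =
  let e₁∈ , e₂₃∈ = ∈-cartesianProduct⁻ E (cartesianProduct E E) t∈triples in
  (e₁∈ , ∈-cartesianProduct⁻ E E e₂₃∈) , motif

map-lookup-allFin : ∀ (xs : List A) → map (List.lookup xs) (allFin (length xs)) ≡ xs
map-lookup-allFin xs = trans (map-tabulate id (List.lookup xs)) (tabulate-lookup xs)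

motifCount≡length-motifs : ∀ H v → motifCount H v ≡ length (motifs (edges H) v)
motifCount≡length-motifs H v = begin
  motifCount H v
    ≡⟨⟩
  length (filter (isMotif? v ∘ lookup₃) indices)
    ≡⟨ length-map lookup₃ (filter (isMotif? v ∘ lookup₃) indices) ⟨
  length (map lookup₃ (filter (isMotif? v ∘ lookup₃) indices))
    ≡⟨ cong length (filter-map (isMotif? v) lookup₃ indices) ⟨
  length (filter (isMotif? v) (map lookup₃ indices))
    ≡⟨ cong (length ∘ filter (isMotif? v)) map-lookup₃ ⟩
  length (motifs (edges H) v)
    ∎
  where
  open ≡-Reasoning
  Index : Set
  Index = Fin (length (edges H))
  lookup₃ : Index × Index × Index → Triple (n H)
  lookup₃ = Product.map (List.lookup (edges H))
              (Product.map (List.lookup (edges H)) (List.lookup (edges H)))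
  indices : List (Index × Index × Index)
  indices = triples (allFin (length (edges H)))
  map-lookup₃ : map lookup₃ indices ≡ triples (edges H)
  map-lookup₃ = trans (map-cartesianProduct _ _ (allFin _) _)
    (cong₂ cartesianProduct (map-lookup-allFin (edges H))
      (trans (map-cartesianProduct _ _ (allFin _) (allFin _))
        (cong₂ cartesianProduct (map-lookup-allFin (edges H)) (map-lookup-allFin (edges H)))))

cloneTriple : ∀ {m} → Triple m → Choice m → Triple (m + m)
cloneTriple (e₁ , e₂ , e₃) c = clone e₁ (cloned₁ c) , clone e₂ (cloned₂ c) , clone e₃ (cloned₃ c)

clonings : ∀ {m} → Triple m → List (Triple (m + m))
clonings t@(e₁ , e₂ , e₃) = map (cloneTriple t) (Cloning.choices e₁ e₂ e₃)

∈-clonings⁻ : ∀ {m} {e₁ e₂ e₃ : Subset m} {z} → z ∈ clonings (e₁ , e₂ , e₃) →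
              ∃ λ c → Cloning.ClonableChoice e₁ e₂ e₃ c × z ≡ cloneTriple (e₁ , e₂ , e₃) c
∈-clonings⁻ {e₁ = e₁} {e₂} {e₃} z∈ with c , c∈ , refl ← ∈-map⁻ _ z∈ =
  c , Cloning.valid⇒clonable e₁ e₂ e₃ c (All.lookup (Cloning.choices-valid e₁ e₂ e₃) c∈) , refl

clonings-unique : ∀ {m} (t : Triple m) → Unique (clonings t)
clonings-unique t@(e₁ , e₂ , e₃) =
  Unique-map⁺-on (cloneTriple t) cloneTriple-injective choices-valid choices-unique
  where
  open Cloning e₁ e₂ e₃
  cloneTriple-injective : ∀ {c c′} → Valid c → Valid c′ →
                          cloneTriple t c ≡ cloneTriple t c′ → c ≡ c′
  cloneTriple-injective {c} {c′} valid valid′ eq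
    with valid⇒clonable c valid | valid⇒clonable c′ valid′
  ... | cl₁ , cl₂ , cl₃ | cl₁′ , cl₂′ , cl₃′ =
    cloned-injective valid valid′
      (proj₂ (clone-injective cl₁ cl₁′ (cong proj₁ eq)))
      (proj₂ (clone-injective cl₂ cl₂′ (cong (proj₁ ∘ proj₂) eq)))
      (proj₂ (clone-injective cl₃ cl₃′ (cong (proj₂ ∘ proj₂) eq)))

clonings-separated : ∀ {m} {t t′ : Triple m} {z} → z ∈ clonings t → z ∈ clonings t′ → t ≡ t′
clonings-separated {t = _ , _ , _} {_ , _ , _} z∈ z∈′
  with _ , (cl₁ , cl₂ , cl₃) , refl ← ∈-clonings⁻ z∈
     | _ , (cl₁′ , cl₂′ , cl₃′) , eq ← ∈-clonings⁻ z∈′ =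
  cong₂ _,_ (proj₁ (clone-injective cl₁ cl₁′ (cong proj₁ eq)))
    (cong₂ _,_ (proj₁ (clone-injective cl₂ cl₂′ (cong (proj₁ ∘ proj₂) eq)))
               (proj₁ (clone-injective cl₃ cl₃′ (cong (proj₂ ∘ proj₂) eq))))

clonings-length : ∀ {m} {v} (t : Triple m) → IsMotif v t → length (clonings t) ≡ weight v
clonings-length {v = v} t@(e₁ , e₂ , e₃) (_ , _ , _ , cardVec≡v) = begin
  length (clonings t)                      ≡⟨ length-map (cloneTriple t) (Cloning.choices e₁ e₂ e₃) ⟩
  length (Cloning.choices e₁ e₂ e₃)        ≡⟨ Cloning.choices-length e₁ e₂ e₃ ⟩
  weight (cardVec e₁ e₂ e₃)                ≡⟨ cong weight cardVec≡v ⟩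
  weight v                                 ∎
  where open ≡-Reasoning

clonings-⊆-motifs : ∀ H {v t} → t ∈ motifs (edges H) v →
                    All (_∈ motifs (edges (ILTH H)) v) (clonings t)
clonings-⊆-motifs H {v} {t@(e₁ , e₂ , e₃)} t∈
  with (e₁∈ , e₂∈ , e₃∈) , (e₁≢e₂ , e₂≢e₃ , e₁≢e₃ , cardVec≡v) ← ∈-motifs⁻ t∈ =
  All.map⁺ (All.map cloned-motif choices-valid)
  where
  open Cloning e₁ e₂ e₃
  cloned-motif : ∀ {c} → Valid c → cloneTriple t c ∈ motifs (edges (ILTH H)) v
  cloned-motif {c} valid with valid⇒clonable c valid
  ... | cl₁ , cl₂ , cl₃ =
    ∈-filter⁺ (isMotif? v)
      (∈-cartesianProduct⁺ (clone-∈-ILTH H e₁∈ cl₁)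
        (∈-cartesianProduct⁺ (clone-∈-ILTH H e₂∈ cl₂) (clone-∈-ILTH H e₃∈ cl₃)))
      ( e₁≢e₂ ∘ proj₁ ∘ clone-injective cl₁ cl₂
      , e₂≢e₃ ∘ proj₁ ∘ clone-injective cl₂ cl₃
      , e₁≢e₃ ∘ proj₁ ∘ clone-injective cl₁ cl₃
      , trans (cardVec-cloned c valid) cardVec≡v )

motifCount-ILTH : ∀ H → Unique (edges H) → ∀ v → motifCount H v * weight v ≤ motifCount (ILTH H) v
motifCount-ILTH H E-unique v = begin
  motifCount H v * weight v
    ≡⟨ cong (_* weight v) (motifCount≡length-motifs H v) ⟩
  length (motifs (edges H) v) * weight v
    ≡⟨ length-concatMap-const clonings (motifs (edges H) v) lengths ⟨
  length (concatMap clonings (motifs (edges H) v))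
    ≤⟨ Unique-⊆⇒length≤ unique ⊆motifs ⟩
  length (motifs (edges (ILTH H)) v)
    ≡⟨ motifCount≡length-motifs (ILTH H) v ⟨
  motifCount (ILTH H) v
    ∎
  where
  open ≤-Reasoning
  lengths : All (λ t → length (clonings t) ≡ weight v) (motifs (edges H) v)
  lengths = All.tabulate λ { {_ , _ , _} t∈ →
    clonings-length _ (proj₂ (∈-motifs⁻ {E = edges H} {v} t∈)) }
  unique : Unique (concatMap clonings (motifs (edges H) v))
  unique = Unique-concatMap⁺ clonings clonings-separated (All.universal clonings-unique _)
             (Unique.filter⁺ (isMotif? v)
               (Unique.cartesianProduct⁺ E-unique (Unique.cartesianProduct⁺ E-unique E-unique)))
  ⊆motifs : All (_∈ motifs (edges (ILTH H)) v) (concatMap clonings (motifs (edges H) v))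
  ⊆motifs = All.concat⁺ (All.map⁺ (All.tabulate (clonings-⊆-motifs H)))

lemma4 : (k : ℕ) → k ≥ 2 → (H₀ : Hypergraph) → IsUniform k H₀ →
    (t : ℕ) → (a b c d e f g x : ℕ) →
    motifCount (ILTH^ t H₀) (a ∷ b ∷ c ∷ d ∷ e ∷ f ∷ g ∷ []) ≡ x →
    x * (g + suc c * d + suc b * f + suc a * e + suc a * suc b * suc c)
    ≤ motifCount (ILTH^ (suc t) H₀) (a ∷ b ∷ c ∷ d ∷ e ∷ f ∷ g ∷ [])
lemma4 _ _ H₀ (_ , H₀-unique) t a b c d e f g _ refl =
  motifCount-ILTH (ILTH^ t H₀) (ILTH^-unique t H₀ H₀-unique) (a ∷ b ∷ c ∷ d ∷ e ∷ f ∷ g ∷ [])
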